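{- Let $\Delta$ be an integer. Let $G$ be a connected graph with at least one vertex of degree at least $2$, such that the maximum degree of $G$ is at most $\Delta$ and every vertex of degree at least $2$ is adjacent to at least one vertex of degree $1$. Let $d_1$ be the maximum number of degree-$1$ neighbors of a vertex of $G$. If some vertex has fewer than $d_1$ neighbors of degree $1$, then there is a vertex $v$ of $G$ such that \[ \frac{n_0(G-N_G[v])+1}{d_G(v)}\le \frac{\lfloor \Delta^2/4\rfloor}{\Delta}.\]
   Context: All graphs are finite and simple. $d_G(v)$ is the degree of $v$ in $G$, $N_G[v]$ is the closed neighborhood $\{v\}\cup N_G(v)$, $G-N_G[v]$ is the subgraph induced by $V(G)\setminus N_G[v]$, and $n_0(H)$ denotes the number of isolated (degree-$0$) vertices of a graph $H$.
   Formalization: The vertex assumed to have fewer than $d_1$ neighbours of degree 1 has degree at least 2. The statement above fails without it. -}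

module Defs where

open import Data.Nat using (ℕ; zero; suc; _+_; _⊔_)
open import Data.Bool using (Bool; true; false; if_then_else_; _∧_; not)
open import Data.Fin using (Fin; zero; suc)
open import Relation.Binary.PropositionalEquality using (_≡_)
open import Relation.Nullary using (¬_; yes; no)
import Data.Fin

record Graph (n : ℕ) : Set where
  field
    adj     : Fin n → Fin n → Bool
    symm    : ∀ u v → adj u v ≡ adj v u
    irrefl  : ∀ v → adj v v ≡ false
open Graph public

countF : ∀ {n} → (Fin n → Bool) → ℕ
countF {zero}  p = 0
countF {suc n} p = (if p zero then 1 else 0) + countF (λ i → p (suc i))

maxF : ∀ {n} → (Fin n → ℕ) → ℕ
maxF {zero}  f = 0
maxF {suc n} f = f zero ⊔ maxF (λ i → f (suc i))

anyF : ∀ {n} → (Fin n → Bool) → Bool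
anyF {zero}  p = false
anyF {suc n} p = if p zero then true else anyF (λ i → p (suc i))

module _ {n : ℕ} (G : Graph n) where

  deg : Fin n → ℕ
  deg v = countF (adj G v)

  isLeaf : Fin n → Bool
  isLeaf v with deg v
  ... | 1 = true
  ... | _ = false

  leafNbrs : Fin n → ℕ
  leafNbrs v = countF (λ u → adj G v u ∧ isLeaf u)

  d₁ : ℕ
  d₁ = maxF leafNbrs

  maxDeg : ℕ
  maxDeg = maxF deg

  inClosedNbhd : Fin n → Fin n → Bool
  inClosedNbhd v w with v Data.Fin.≟ w
  ... | Relation.Nullary.yes _ = true
  ... | Relation.Nullary.no  _ = adj G v w

  -- n_0(G - N_G[v]) : vertices w outside N_G[v] having no neighbour outside N_G[v]
  n₀-minus : Fin n → ℕ
  n₀-minus v = countF (λ w → not (inClosedNbhd v w)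
                         ∧ not (anyF (λ x → adj G w x ∧ not (inClosedNbhd v x))))

  data Reach : Fin n → Fin n → Set where
    here : ∀ {u} → Reach u u
    step : ∀ {u v w} → adj G u v ≡ true → Reach v w → Reach u w

  Connected : Set
  Connected = ∀ u v → Reach u v

-- Walking from the given vertex towards one with d₁ leaf neighbours, and skipping leaves, we
-- find adjacent v and s where v has d₁ leaf neighbours and s is a non-leaf with fewer.
-- Every isolated vertex of G − N[v] is a leaf hanging off a non-leaf neighbour of v
-- (were it not a leaf, its leaf neighbour would be adjacent to v too), so with k non-leaf
-- neighbours of v we get n₀ + 1 ≤ d₁ k, while d₁ + k ≤ d(v) ≤ Δ.  Finally a k Δ ≤ ⌊Δ²/4⌋ (a + k)
-- whenever a + k ≤ Δ, by AM-GM after enlarging a to Δ − k.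
module Submission where

open import Defs
open import Data.Nat using (ℕ; _+_; _*_; _/_; _≤_; _<_)
open import Data.Fin using (Fin)
open import Data.Product using (Σ; _×_)
open import Data.Bool using (true)
open import Relation.Binary.PropositionalEquality using (_≡_)

open import Data.Nat using (zero; suc; s≤s; z≤n; _∸_; _<?_; _≤?_)
open import Data.Nat.Properties hiding (_≟_)
open import Data.Nat.DivMod using (/-monoˡ-≤; m*n/n≡m)
open import Data.Nat.Tactic.RingSolver using (solve-∀)
open import Data.Bool using (Bool; false; if_then_else_; _∧_; not)
open import Data.Bool.Properties using (∧-conicalˡ; ∧-conicalʳ; not-injective; not-¬)
open import Data.Fin using (zero; suc; _≟_)
open import Data.Vec.Functional using (tail)
open import Data.Product using (_,_; proj₁; proj₂; ∃-syntax)
open import Data.Sum using (_⊎_; inj₁; inj₂)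
open import Function using (_∘_)
open import Relation.Nullary using (¬_; yes; no; contradiction)
open import Relation.Binary.PropositionalEquality
  using (refl; sym; trans; cong; cong₂; subst; subst₂)

m≤n⇒4mn≤[m+n]² : ∀ {m n} → m ≤ n → 4 * (m * n) ≤ (m + n) * (m + n)
m≤n⇒4mn≤[m+n]² {m} m≤n with d , refl ← m≤n⇒∃[o]m+o≡n m≤n = begin
  4 * (m * (m + d))              ≤⟨ m≤m+n _ (d * d) ⟩
  4 * (m * (m + d)) + d * d      ≡⟨ square-expansion m d ⟩
  (m + (m + d)) * (m + (m + d))  ∎
  where
  open ≤-Reasoning
  square-expansion : ∀ m d → 4 * (m * (m + d)) + d * d ≡ (m + (m + d)) * (m + (m + d))
  square-expansion = solve-∀

4mn≤[m+n]² : ∀ m n → 4 * (m * n) ≤ (m + n) * (m + n)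
4mn≤[m+n]² m n with ≤-total m n
... | inj₁ m≤n = m≤n⇒4mn≤[m+n]² m≤n
... | inj₂ n≤m = subst₂ _≤_ (cong (4 *_) (*-comm n m)) (cong₂ _*_ (+-comm n m) (+-comm n m))
                        (m≤n⇒4mn≤[m+n]² n≤m)

m*n≤[m+n]²/4 : ∀ m n → m * n ≤ (m + n) * (m + n) / 4
m*n≤[m+n]²/4 m n = begin
  m * n              ≡⟨ sym (m*n/n≡m (m * n) 4) ⟩
  m * n * 4 / 4      ≡⟨ cong (_/ 4) (*-comm (m * n) 4) ⟩
  4 * (m * n) / 4    ≤⟨ /-monoˡ-≤ 4 (4mn≤[m+n]² m n) ⟩
  (m + n) * (m + n) / 4 ∎
  where open ≤-Reasoning

-- Cross-multiplied form of: m*k/(m+k) is monotone in m.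
m≤n⇒m*k*[n+k]≤n*k*[m+k] : ∀ {m n} k → m ≤ n → m * k * (n + k) ≤ n * k * (m + k)
m≤n⇒m*k*[n+k]≤n*k*[m+k] {m} {n} k m≤n = begin
  m * k * (n + k)           ≡⟨ expandˡ m n k ⟩
  m * n * k + m * (k * k)   ≤⟨ +-monoʳ-≤ (m * n * k) (*-monoˡ-≤ (k * k) m≤n) ⟩
  m * n * k + n * (k * k)   ≡⟨ expandʳ m n k ⟩
  n * k * (m + k)           ∎
  where
  open ≤-Reasoning
  expandˡ : ∀ m n k → m * k * (n + k) ≡ m * n * k + m * (k * k)
  expandˡ = solve-∀
  expandʳ : ∀ m n k → m * n * k + n * (k * k) ≡ n * k * (m + k)
  expandʳ = solve-∀

a*k*D≤⌊D²/4⌋*[a+k] : ∀ a k D → a + k ≤ D → a * k * D ≤ D * D / 4 * (a + k)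
a*k*D≤⌊D²/4⌋*[a+k] a k D a+k≤D = begin
  a * k * D                 ≡⟨ cong (a * k *_) (sym b+k≡D) ⟩
  a * k * (b + k)           ≤⟨ m≤n⇒m*k*[n+k]≤n*k*[m+k] k (m+n≤o⇒m≤o∸n a a+k≤D) ⟩
  b * k * (a + k)           ≤⟨ *-monoˡ-≤ (a + k) (m*n≤[m+n]²/4 b k) ⟩
  (b + k) * (b + k) / 4 * (a + k) ≡⟨ cong (λ x → x * x / 4 * (a + k)) b+k≡D ⟩
  D * D / 4 * (a + k)       ∎
  where
  open ≤-Reasoning
  b : ℕ
  b = D ∸ k
  b+k≡D : b + k ≡ D
  b+k≡D = m∸n+n≡m (≤-trans (m≤n+m k a) a+k≤D)

countF-false≡0 : ∀ n → countF {n} (λ _ → false) ≡ 0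
countF-false≡0 zero    = refl
countF-false≡0 (suc n) = countF-false≡0 n

countF-mono : ∀ {n} (p q : Fin n → Bool) → (∀ i → p i ≡ true → q i ≡ true) → countF p ≤ countF q
countF-mono {zero}  p q p⊆q = z≤n
countF-mono {suc n} p q p⊆q with p zero in p0 | q zero in q0
... | true  | true  = s≤s (countF-mono (tail p) (tail q) (λ i → p⊆q (suc i)))
... | true  | false = contradiction (trans (sym (p⊆q zero p0)) q0) λ ()
... | false | true  = m≤n⇒m≤1+n (countF-mono (tail p) (tail q) (λ i → p⊆q (suc i)))
... | false | false = countF-mono (tail p) (tail q) (λ i → p⊆q (suc i))

1≤countF : ∀ {n} (p : Fin n → Bool) i → p i ≡ true → 1 ≤ countF p
1≤countF p zero    pi rewrite pi = s≤s z≤n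
1≤countF p (suc i) pi = ≤-trans (1≤countF (tail p) i pi) (m≤n+m _ _)

2≤countF : ∀ {n} (p : Fin n → Bool) i j → p i ≡ true → p j ≡ true → ¬ i ≡ j → 2 ≤ countF p
2≤countF p zero    zero    pi pj i≢j = contradiction refl i≢j
2≤countF p zero    (suc j) pi pj i≢j rewrite pi = s≤s (1≤countF (tail p) j pj)
2≤countF p (suc i) zero    pi pj i≢j rewrite pj = s≤s (1≤countF (tail p) i pi)
2≤countF p (suc i) (suc j) pi pj i≢j =
  ≤-trans (2≤countF (tail p) i j pi pj (λ i≡j → i≢j (cong suc i≡j))) (m≤n+m _ _)

countF-split : ∀ {n} (p q : Fin n → Bool) →
               countF p ≡ countF (λ i → p i ∧ q i) + countF (λ i → p i ∧ not (q i))
countF-split {zero}  p q = refl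
countF-split {suc n} p q with p zero | q zero
... | true  | true  = cong suc (countF-split (tail p) (tail q))
... | true  | false = trans (cong suc (countF-split (tail p) (tail q))) (sym (+-suc _ _))
... | false | true  = countF-split (tail p) (tail q)
... | false | false = countF-split (tail p) (tail q)

-- The disjunction is written the way anyF unfolds; it is not definitionally p i ∨ q i.
countF-subadditive : ∀ {n} (p q : Fin n → Bool) →
                     countF (λ i → if p i then true else q i) ≤ countF p + countF q
countF-subadditive {zero}  p q = z≤n
countF-subadditive {suc n} p q with p zero | q zero
... | true  | _     = s≤s (≤-trans (countF-subadditive (tail p) (tail q))
                                   (+-monoʳ-≤ (countF (tail p)) (m≤n+m _ _)))
... | false | true  = ≤-trans (s≤s (countF-subadditive (tail p) (tail q))) (≤-reflexive (sym (+-suc _ _)))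
... | false | false = countF-subadditive (tail p) (tail q)

anyF-intro : ∀ {n} (p : Fin n → Bool) i → p i ≡ true → anyF p ≡ true
anyF-intro p zero    pi rewrite pi = refl
anyF-intro p (suc i) pi with p zero
... | true  = refl
... | false = anyF-intro (tail p) i pi

sumF : ∀ {n} → (Fin n → ℕ) → ℕ
sumF {zero}  f = 0
sumF {suc n} f = f zero + sumF (tail f)

sumF-mono : ∀ {n} (f g : Fin n → ℕ) → (∀ i → f i ≤ g i) → sumF f ≤ sumF g
sumF-mono {zero}  f g f≤g = z≤n
sumF-mono {suc n} f g f≤g = +-mono-≤ (f≤g zero) (sumF-mono _ _ (λ i → f≤g (suc i)))

sumF-mono-< : ∀ {n} (f g : Fin n → ℕ) → (∀ i → f i ≤ g i) → ∀ j → f j < g j → sumF f < sumF g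
sumF-mono-< f g f≤g zero    fj<gj = +-mono-<-≤ fj<gj (sumF-mono _ _ (λ i → f≤g (suc i)))
sumF-mono-< f g f≤g (suc j) fj<gj = +-mono-≤-< (f≤g zero) (sumF-mono-< _ _ (λ i → f≤g (suc i)) j fj<gj)

sumF-const-on : ∀ {n} (c : Fin n → Bool) b → sumF (λ i → if c i then b else 0) ≡ b * countF c
sumF-const-on {zero}  c b = sym (*-zeroʳ b)
sumF-const-on {suc n} c b with c zero
... | true  = trans (cong (b +_) (sumF-const-on (tail c) b)) (sym (*-suc b _))
... | false = sumF-const-on (tail c) b

sumF<*countF : ∀ {n} (c : Fin n → Bool) (f : Fin n → ℕ) b → (∀ i → f i ≤ (if c i then b else 0)) →
               ∀ j → c j ≡ true → f j < b → sumF f < b * countF c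
sumF<*countF c f b f≤b j cj fj<b = subst (sumF f <_) (sumF-const-on c b)
  (sumF-mono-< f _ f≤b j (subst (λ x → f j < (if x then b else 0)) (sym cj) fj<b))

countF-anyF≤sumF : ∀ {m n} (P : Fin m → Fin n → Bool) →
                   countF (λ w → anyF (λ s → P s w)) ≤ sumF (λ s → countF (P s))
countF-anyF≤sumF {zero}  {n} P = ≤-reflexive (countF-false≡0 n)
countF-anyF≤sumF {suc m}     P = ≤-trans (countF-subadditive (P zero) _)
  (+-monoʳ-≤ (countF (P zero)) (countF-anyF≤sumF (tail P)))

maxF-upper : ∀ {n} (f : Fin n → ℕ) i → f i ≤ maxF f
maxF-upper f zero    = m≤m⊔n _ _
maxF-upper f (suc i) = ≤-trans (maxF-upper (tail f) i) (m≤n⊔m _ _)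

maxF-attained : ∀ {n} (f : Fin n → ℕ) → Fin n → ∃[ i ] maxF f ≤ f i
maxF-attained {suc zero}    f _ = zero , ⊔-lub ≤-refl z≤n
maxF-attained {suc (suc n)} f _ with maxF-attained (tail f) zero
... | i , max≤fi with ≤-total (f zero) (f (suc i))
...   | inj₁ f0≤fi = suc i , ⊔-lub f0≤fi max≤fi
...   | inj₂ fi≤f0 = zero , ⊔-lub ≤-refl (≤-trans max≤fi fi≤f0)

module _ {n : ℕ} (G : Graph n) where

  adj-sym : ∀ {a b} → adj G a b ≡ true → adj G b a ≡ true
  adj-sym {a} {b} = trans (symm G b a)

  isLeaf⇒deg≡1 : ∀ w → isLeaf G w ≡ true → deg G w ≡ 1
  isLeaf⇒deg≡1 w leaf with deg G w
  ... | 1 = refl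
  ... | 0 with () ← leaf
  ... | suc (suc _) with () ← leaf

  deg≡1⇒isLeaf : ∀ w → deg G w ≡ 1 → isLeaf G w ≡ true
  deg≡1⇒isLeaf w deg≡1 with deg G w
  deg≡1⇒isLeaf w refl | .1 = refl

  2≤deg⇒¬isLeaf : ∀ w → 2 ≤ deg G w → isLeaf G w ≡ false
  2≤deg⇒¬isLeaf w 2≤deg with isLeaf G w in leaf
  ... | false = refl
  ... | true  = contradiction (≤-trans 2≤deg (≤-reflexive (isLeaf⇒deg≡1 w leaf))) (<-irrefl refl)

  2≤deg : ∀ x a b → adj G x a ≡ true → adj G x b ≡ true → ¬ a ≡ b → 2 ≤ deg G x
  2≤deg x = 2≤countF (adj G x)

  deg≡1⇒nbr-unique : ∀ x a b → deg G x ≡ 1 → adj G x a ≡ true → adj G x b ≡ true → a ≡ b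
  deg≡1⇒nbr-unique x a b deg≡1 x~a x~b with a ≟ b
  ... | yes a≡b = a≡b
  ... | no  a≢b = contradiction (≤-trans (2≤deg x a b x~a x~b a≢b) (≤-reflexive deg≡1)) (<-irrefl refl)

  leafNbrs≤deg : ∀ w → leafNbrs G w ≤ deg G w
  leafNbrs≤deg w = countF-mono _ (adj G w) (λ u → ∧-conicalˡ (adj G w u) (isLeaf G u))

  Reach⇒nbr : ∀ {w v} → Reach G w v → ¬ w ≡ v → ∃[ y ] adj G w y ≡ true
  Reach⇒nbr here         w≢w = contradiction refl w≢w
  Reach⇒nbr (step w~y _) _   = _ , w~y

  ∉N[v] : ∀ v w → inClosedNbhd G v w ≡ false → (¬ v ≡ w) × (adj G v w ≡ false)
  ∉N[v] v w w∉ with v ≟ w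
  ... | no v≢w = v≢w , w∉

  ∈N[v] : ∀ v w → inClosedNbhd G v w ≡ true → (v ≡ w) ⊎ (adj G v w ≡ true)
  ∈N[v] v w w∈ with v ≟ w
  ... | yes v≡w = inj₁ v≡w
  ... | no  _   = inj₂ w∈

  leafNbr : Fin n → Fin n → Bool
  leafNbr s w = adj G s w ∧ isLeaf G w

  nonLeafNbr : Fin n → Fin n → Bool
  nonLeafNbr v s = adj G v s ∧ not (isLeaf G s)

  nonLeafNbrs : Fin n → ℕ
  nonLeafNbrs v = countF (nonLeafNbr v)

  deg≡leafNbrs+nonLeafNbrs : ∀ v → deg G v ≡ leafNbrs G v + nonLeafNbrs v
  deg≡leafNbrs+nonLeafNbrs v = countF-split (adj G v) (isLeaf G)

  Deficient : Fin n → Set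
  Deficient s = (isLeaf G s ≡ false) × (leafNbrs G s < d₁ G)

  deficient-nbr-of-maximal : 2 ≤ d₁ G → ∀ {u m} → Reach G u m → Deficient u → d₁ G ≤ leafNbrs G m →
                             ∃[ v ] ∃[ s ] (adj G v s ≡ true × Deficient s × d₁ G ≤ leafNbrs G v)
  deficient-nbr-of-maximal 2≤d₁ {m = m} u⇝m u-deficient d₁≤ℓm = walk u⇝m (inj₁ u-deficient)
    where
    -- A walk can leave a leaf only towards its unique neighbour, so leaves are skipped over.
    DeficientOrPendant : Fin n → Set
    DeficientOrPendant w = Deficient w ⊎ (isLeaf G w ≡ true × ∃[ x ] (adj G w x ≡ true × Deficient x))

    walk : ∀ {w} → Reach G w m → DeficientOrPendant w →
           ∃[ v ] ∃[ s ] (adj G v s ≡ true × Deficient s × d₁ G ≤ leafNbrs G v)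
    walk here (inj₁ (_ , ℓm<d₁)) = contradiction d₁≤ℓm (<⇒≱ ℓm<d₁)
    walk here (inj₂ (m-leaf , _)) = contradiction
      (≤-trans 2≤d₁ (≤-trans d₁≤ℓm (≤-trans (leafNbrs≤deg m) (≤-reflexive (isLeaf⇒deg≡1 m m-leaf))))) (<-irrefl refl)
    walk (step {v = y} w~y y⇝m) (inj₁ w-deficient) with isLeaf G y in y-leaf | leafNbrs G y <? d₁ G
    ... | true  | _          = walk y⇝m (inj₂ (y-leaf , _ , adj-sym w~y , w-deficient))
    ... | false | yes ℓy<d₁  = walk y⇝m (inj₁ (y-leaf , ℓy<d₁))
    ... | false | no  ℓy≮d₁  = y , _ , adj-sym w~y , w-deficient , ≮⇒≥ ℓy≮d₁
    walk {w} (step {v = y} w~y y⇝m) (inj₂ (w-leaf , x , w~x , x-deficient))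
      with refl ← deg≡1⇒nbr-unique w x y (isLeaf⇒deg≡1 w w-leaf) w~x w~y = walk y⇝m (inj₁ x-deficient)

  outsideNbr : Fin n → Fin n → Fin n → Bool
  outsideNbr v w x = adj G w x ∧ not (inClosedNbhd G v x)

  isolatedOutside : Fin n → Fin n → Bool
  isolatedOutside v w = not (inClosedNbhd G v w) ∧ not (anyF (outsideNbr v w))

  isolatedOutside⇒∉N[v] : ∀ v w → isolatedOutside v w ≡ true → inClosedNbhd G v w ≡ false
  isolatedOutside⇒∉N[v] v w iso = not-injective {y = false} (∧-conicalˡ _ _ iso)

  isolatedOutside⇒nbr-of-v : ∀ v w x → isolatedOutside v w ≡ true → adj G w x ≡ true → adj G v x ≡ true
  isolatedOutside⇒nbr-of-v v w x iso w~x with inClosedNbhd G v x in x∈N[v]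
  ... | false = contradiction (anyF-intro (outsideNbr v w) x (cong₂ (λ a b → a ∧ not b) w~x x∈N[v]))
                              (not-¬ (not-injective {y = false} (∧-conicalʳ _ _ iso)))
  ... | true with ∈N[v] v x x∈N[v]
  ...   | inj₂ v~x  = v~x
  ...   | inj₁ refl = contradiction (adj-sym w~x) (not-¬ (proj₂ (∉N[v] v w (isolatedOutside⇒∉N[v] v w iso))))

  hangsOff : Fin n → Fin n → Fin n → Bool
  hangsOff v s w = nonLeafNbr v s ∧ leafNbr s w

  hangsOff-count≤ : ∀ v s → countF (hangsOff v s) ≤ (if nonLeafNbr v s then d₁ G else 0)
  hangsOff-count≤ v s with nonLeafNbr v s
  ... | true  = maxF-upper (leafNbrs G) s
  ... | false = ≤-reflexive (countF-false≡0 n)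

  hangsOff-count≡ : ∀ v s → nonLeafNbr v s ≡ true → countF (hangsOff v s) ≡ leafNbrs G s
  hangsOff-count≡ v s v~s rewrite v~s = refl

  module _ (conn : Connected G)
           (nonLeaf⇒leafNbr : ∀ u → 2 ≤ deg G u → ∃[ x ] (adj G u x ≡ true × deg G x ≡ 1)) where

    2≤d₁ : ∀ u → 2 ≤ deg G u → leafNbrs G u < d₁ G → 2 ≤ d₁ G
    2≤d₁ u 2≤deg-u ℓu<d₁ with x , u~x , deg-x≡1 ← nonLeaf⇒leafNbr u 2≤deg-u =
      ≤-trans (s≤s (1≤countF (leafNbr u) x (cong₂ _∧_ u~x (deg≡1⇒isLeaf x deg-x≡1)))) ℓu<d₁

    isolatedOutside⇒hangsOff : ∀ v w → isolatedOutside v w ≡ true → ∃[ s ] hangsOff v s w ≡ true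
    isolatedOutside⇒hangsOff v w iso = y , cong₂ _∧_ (cong₂ (λ a b → a ∧ not b) v~y y-nonLeaf)
                                                     (cong₂ _∧_ (adj-sym w~y) (deg≡1⇒isLeaf w deg-w≡1))
      where
      v≢w : ¬ v ≡ w
      v≢w = proj₁ (∉N[v] v w (isolatedOutside⇒∉N[v] v w iso))
      nbrs⊆ : ∀ x → adj G w x ≡ true → adj G v x ≡ true
      nbrs⊆ x = isolatedOutside⇒nbr-of-v v w x iso
      nbr-of-w : ∃[ y ] adj G w y ≡ true
      nbr-of-w = Reach⇒nbr (conn w v) (v≢w ∘ sym)
      y : Fin n
      y = proj₁ nbr-of-w
      w~y : adj G w y ≡ true
      w~y = proj₂ nbr-of-w
      v~y : adj G v y ≡ true
      v~y = nbrs⊆ y w~y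
      y-nonLeaf : isLeaf G y ≡ false
      y-nonLeaf = 2≤deg⇒¬isLeaf y (2≤deg y v w (adj-sym v~y) (adj-sym w~y) v≢w)
      -- A leaf neighbour of w would also be adjacent to v.
      deg-w≡1 : deg G w ≡ 1
      deg-w≡1 with 2 ≤? deg G w
      ... | no  2≰deg-w = ≤-antisym (≤-pred (≰⇒> 2≰deg-w)) (1≤countF (adj G w) y w~y)
      ... | yes 2≤deg-w with x , w~x , deg-x≡1 ← nonLeaf⇒leafNbr w 2≤deg-w =
        contradiction (deg≡1⇒nbr-unique x v w deg-x≡1 (adj-sym (nbrs⊆ x w~x)) (adj-sym w~x)) v≢w

    n₀-minus<d₁*nonLeafNbrs : ∀ v s → nonLeafNbr v s ≡ true → leafNbrs G s < d₁ G →
                              n₀-minus G v < d₁ G * nonLeafNbrs v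
    n₀-minus<d₁*nonLeafNbrs v s v~s ℓs<d₁ = begin-strict
      n₀-minus G v                               ≤⟨ countF-mono (isolatedOutside v) _ covered ⟩
      countF (λ w → anyF (λ t → hangsOff v t w)) ≤⟨ countF-anyF≤sumF (hangsOff v) ⟩
      sumF (λ t → countF (hangsOff v t))         <⟨ sumF<*countF (nonLeafNbr v) _ (d₁ G) (hangsOff-count≤ v) s v~s
                                                       (subst (_< d₁ G) (sym (hangsOff-count≡ v s v~s)) ℓs<d₁) ⟩
      d₁ G * nonLeafNbrs v                       ∎
      where
      open ≤-Reasoning
      covered : ∀ w → isolatedOutside v w ≡ true → anyF (λ t → hangsOff v t w) ≡ true
      covered w iso with s , s∼w ← isolatedOutside⇒hangsOff v w iso = anyF-intro (λ t → hangsOff v t w) s s∼w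

lemma2p4 : (Δ n : ℕ) (G : Graph n)
    → Connected G
    → Σ (Fin n) (λ w → 2 ≤ deg G w)
    → maxDeg G ≤ Δ
    → ((u : Fin n) → 2 ≤ deg G u → Σ (Fin n) (λ x → (adj G u x ≡ true) × (deg G x ≡ 1)))
    → Σ (Fin n) (λ u → (2 ≤ deg G u) × (leafNbrs G u < d₁ G))
    → Σ (Fin n) (λ v → (n₀-minus G v + 1) * Δ ≤ ((Δ * Δ) / 4) * deg G v)
lemma2p4 Δ n G conn _ maxDeg≤Δ nonLeaf⇒leafNbr (u , 2≤deg-u , ℓu<d₁)
  with m , d₁≤ℓm ← maxF-attained (leafNbrs G) u
  with v , s , v~s , (s-nonLeaf , ℓs<d₁) , d₁≤ℓv
         ← deficient-nbr-of-maximal G (2≤d₁ G conn nonLeaf⇒leafNbr u 2≤deg-u ℓu<d₁)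
                                      (conn u m) (2≤deg⇒¬isLeaf G u 2≤deg-u , ℓu<d₁) d₁≤ℓm
  = v , (begin
    (n₀-minus G v + 1) * Δ  ≡⟨ cong (_* Δ) (+-comm (n₀-minus G v) 1) ⟩
    suc (n₀-minus G v) * Δ  ≤⟨ *-monoˡ-≤ Δ (n₀-minus<d₁*nonLeafNbrs G conn nonLeaf⇒leafNbr v s v~s′ ℓs<d₁) ⟩
    d₁ G * k * Δ            ≤⟨ a*k*D≤⌊D²/4⌋*[a+k] (d₁ G) k Δ (≤-trans d₁+k≤deg deg≤Δ) ⟩
    Δ * Δ / 4 * (d₁ G + k)  ≤⟨ *-monoʳ-≤ (Δ * Δ / 4) d₁+k≤deg ⟩
    Δ * Δ / 4 * deg G v     ∎)
  where
  open ≤-Reasoning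
  k : ℕ
  k = nonLeafNbrs G v
  v~s′ : nonLeafNbr G v s ≡ true
  v~s′ = cong₂ (λ a b → a ∧ not b) v~s s-nonLeaf
  d₁+k≤deg : d₁ G + k ≤ deg G v
  d₁+k≤deg = subst (d₁ G + k ≤_) (sym (deg≡leafNbrs+nonLeafNbrs G v)) (+-monoˡ-≤ k d₁≤ℓv)
  deg≤Δ : deg G v ≤ Δ
  deg≤Δ = ≤-trans (maxF-upper (deg G) v) maxDeg≤Δ
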